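{- Up to isomorphism, the only biclosed monoidal structures on the category $\mathsf{Graph}$ of undirected reflexive graphs are the box product $\square$ and the categorical product $\boxtimes$.
   Context: An undirected graph is a set $G(V)$ of vertices with a reflexive, symmetric relation $\sim$; a morphism is a function on vertices preserving the relation. This gives the category $\mathsf{Graph}$. For graphs $G,H$: the box product $G \square H$ has vertex set $G(V)\times H(V)$ with $(g,h)\sim(g',h')$ iff ($g=g'$ and $h\sim h'$) or ($g\sim g'$ and $h=h'$); the categorical product $G\boxtimes H$ has the same vertex set with $(g,h)\sim(g',h')$ iff $g\sim g'$ and $h\sim h'$. A monoidal category $(\mathcal{C},\otimes,I)$ is biclosed if for every object $X$ both $X\otimes -$ and $-\otimes X$ have right adjoints. -}

module Defs where

open import Level using (0ℓ)
open import Data.Unit using (⊤; tt)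
open import Data.Product using (_×_; _,_; proj₁; proj₂)
open import Data.Sum using (_⊎_; inj₁; inj₂)
open import Relation.Binary using (Rel; IsEquivalence)

-- Constructive rendering: the vertex "set" is a setoid (a type with an
-- equivalence relation _≈_), the edge relation _∼_ is reflexive,
-- symmetric and respects _≈_.

record Graph : Set₁ where
  field
    V             : Set
    _≈_           : Rel V 0ℓ
    isEquivalence : IsEquivalence _≈_
    _∼_           : Rel V 0ℓ
    ∼-refl        : ∀ {x} → x ∼ x
    ∼-sym         : ∀ {x y} → x ∼ y → y ∼ x
    ∼-resp        : ∀ {x x′ y y′} → x ≈ x′ → y ≈ y′ → x ∼ y → x′ ∼ y′

  open IsEquivalence isEquivalence public
    renaming (refl to ≈-refl; sym to ≈-sym; trans to ≈-trans)

open Graph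

record Hom (G H : Graph) : Set where
  field
    fun      : V G → V H
    fun-cong : ∀ {x y} → _≈_ G x y → _≈_ H (fun x) (fun y)
    fun-∼    : ∀ {x y} → _∼_ G x y → _∼_ H (fun x) (fun y)

open Hom

infix 4 _≗_
_≗_ : ∀ {G H} → Hom G H → Hom G H → Set
_≗_ {G} {H} f g = ∀ x → _≈_ H (fun f x) (fun g x)

idH : ∀ {G} → Hom G G
idH = record { fun = λ x → x ; fun-cong = λ p → p ; fun-∼ = λ p → p }

infixr 9 _∘H_
_∘H_ : ∀ {G H K} → Hom H K → Hom G H → Hom G K
g ∘H f = record
  { fun = λ x → fun g (fun f x)
  ; fun-cong = λ p → fun-cong g (fun-cong f p)
  ; fun-∼ = λ p → fun-∼ g (fun-∼ f p) }

record Iso (G H : Graph) : Set where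
  field
    to      : Hom G H
    from    : Hom H G
    to∘from : to ∘H from ≗ idH
    from∘to : from ∘H to ≗ idH

open Iso

record Monoidal : Set₁ where
  infixr 10 _⊗₀_ _⊗₁_
  field
    _⊗₀_   : Graph → Graph → Graph
    _⊗₁_   : ∀ {A B C D} → Hom A B → Hom C D → Hom (A ⊗₀ C) (B ⊗₀ D)
    ⊗-resp : ∀ {A B C D} {f f′ : Hom A B} {g g′ : Hom C D} →
             f ≗ f′ → g ≗ g′ → f ⊗₁ g ≗ f′ ⊗₁ g′
    ⊗-id   : ∀ {A C} → idH {A} ⊗₁ idH {C} ≗ idH
    ⊗-∘    : ∀ {A B B′ C D D′} (f : Hom B B′) (f′ : Hom A B)
               (g : Hom D D′) (g′ : Hom C D) →
             (f ∘H f′) ⊗₁ (g ∘H g′) ≗ (f ⊗₁ g) ∘H (f′ ⊗₁ g′)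
    unit   : Graph
    α      : ∀ A B C → Iso ((A ⊗₀ B) ⊗₀ C) (A ⊗₀ (B ⊗₀ C))
    λ≅     : ∀ A → Iso (unit ⊗₀ A) A
    ρ≅     : ∀ A → Iso (A ⊗₀ unit) A
    α-nat  : ∀ {A A′ B B′ C C′} (f : Hom A A′) (g : Hom B B′) (h : Hom C C′) →
             to (α A′ B′ C′) ∘H ((f ⊗₁ g) ⊗₁ h) ≗ (f ⊗₁ (g ⊗₁ h)) ∘H to (α A B C)
    λ-nat  : ∀ {A A′} (f : Hom A A′) →
             to (λ≅ A′) ∘H (idH ⊗₁ f) ≗ f ∘H to (λ≅ A)
    ρ-nat  : ∀ {A A′} (f : Hom A A′) →
             to (ρ≅ A′) ∘H (f ⊗₁ idH) ≗ f ∘H to (ρ≅ A)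
    pentagon : ∀ A B C D →
             to (α A B (C ⊗₀ D)) ∘H to (α (A ⊗₀ B) C D)
             ≗ (idH ⊗₁ to (α B C D)) ∘H to (α A (B ⊗₀ C) D) ∘H (to (α A B C) ⊗₁ idH)
    triangle : ∀ A B →
             (idH ⊗₁ to (λ≅ B)) ∘H to (α A unit B) ≗ to (ρ≅ A) ⊗₁ idH

-- Biclosedness: both X ⊗ - and - ⊗ X have right adjoints, given (as is
-- standard) pointwise by couniversal arrows: an object [X,B] with an
-- evaluation map such that every map out of the tensor factors uniquely.
record Biclosed (M : Monoidal) : Set₁ where
  open Monoidal M
  field
    [_⊸_]   : Graph → Graph → Graph
    evˡ     : ∀ X B → Hom (X ⊗₀ [ X ⊸ B ]) B
    curryˡ  : ∀ {X A B} → Hom (X ⊗₀ A) B → Hom A [ X ⊸ B ]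
    curryˡ-β : ∀ {X A B} (f : Hom (X ⊗₀ A) B) → evˡ X B ∘H (idH ⊗₁ curryˡ f) ≗ f
    curryˡ-unique : ∀ {X A B} (f : Hom (X ⊗₀ A) B) (g : Hom A [ X ⊸ B ]) →
                    evˡ X B ∘H (idH ⊗₁ g) ≗ f → g ≗ curryˡ f
    [_⟜_]   : Graph → Graph → Graph
    evʳ     : ∀ X B → Hom ([ B ⟜ X ] ⊗₀ X) B
    curryʳ  : ∀ {X A B} → Hom (A ⊗₀ X) B → Hom A [ B ⟜ X ]
    curryʳ-β : ∀ {X A B} (f : Hom (A ⊗₀ X) B) → evʳ X B ∘H (curryʳ f ⊗₁ idH) ≗ f
    curryʳ-unique : ∀ {X A B} (f : Hom (A ⊗₀ X) B) (g : Hom A [ B ⟜ X ]) →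
                    evʳ X B ∘H (g ⊗₁ idH) ≗ f → g ≗ curryʳ f

-- Isomorphism of monoidal structures on Graph: a monoidal natural
-- isomorphism, i.e. the identity functor with the structure of a strong
-- monoidal functor (M → N) whose comparison maps are isomorphisms.
record MonoidalIso (M N : Monoidal) : Set₁ where
  module M = Monoidal M
  module N = Monoidal N
  field
    φ     : ∀ A B → Iso (A M.⊗₀ B) (A N.⊗₀ B)
    φ-nat : ∀ {A A′ B B′} (f : Hom A A′) (g : Hom B B′) →
            to (φ A′ B′) ∘H (f M.⊗₁ g) ≗ (f N.⊗₁ g) ∘H to (φ A B)
    ψ     : Iso M.unit N.unit
    φ-α   : ∀ A B C →
            to (N.α A B C) ∘H (to (φ A B) N.⊗₁ idH) ∘H to (φ (A M.⊗₀ B) C)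
            ≗ (idH N.⊗₁ to (φ B C)) ∘H to (φ A (B M.⊗₀ C)) ∘H to (M.α A B C)
    φ-λ   : ∀ A →
            to (N.λ≅ A) ∘H (to ψ N.⊗₁ idH) ∘H to (φ M.unit A) ≗ to (M.λ≅ A)
    φ-ρ   : ∀ A →
            to (N.ρ≅ A) ∘H (idH N.⊗₁ to ψ) ∘H to (φ A M.unit) ≗ to (M.ρ≅ A)

K₁ : Graph
K₁ = record
  { V = ⊤ ; _≈_ = λ _ _ → ⊤
  ; isEquivalence = record { refl = tt ; sym = λ _ → tt ; trans = λ _ _ → tt }
  ; _∼_ = λ _ _ → ⊤ ; ∼-refl = tt ; ∼-sym = λ _ → tt ; ∼-resp = λ _ _ _ → tt }

module _ (G H : Graph) where
  _≈×_ : Rel (V G × V H) 0ℓ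
  (g , h) ≈× (g′ , h′) = _≈_ G g g′ × _≈_ H h h′

  ≈×-isEquivalence : IsEquivalence _≈×_
  ≈×-isEquivalence = record
    { refl  = ≈-refl G , ≈-refl H
    ; sym   = λ (p , q) → ≈-sym G p , ≈-sym H q
    ; trans = λ (p , q) (p′ , q′) → ≈-trans G p p′ , ≈-trans H q q′ }

infixr 10 _□_ _⊠_
_□_ : Graph → Graph → Graph
G □ H = record
  { V = V G × V H
  ; _≈_ = _≈×_ G H
  ; isEquivalence = ≈×-isEquivalence G H
  ; _∼_ = λ (g , h) (g′ , h′) →
          (_≈_ G g g′ × _∼_ H h h′) ⊎ (_∼_ G g g′ × _≈_ H h h′)
  ; ∼-refl = inj₁ (≈-refl G , ∼-refl H)
  ; ∼-sym = λ { (inj₁ (p , q)) → inj₁ (≈-sym G p , ∼-sym H q)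
              ; (inj₂ (p , q)) → inj₂ (∼-sym G p , ≈-sym H q) }
  ; ∼-resp = λ { (a , b) (c , d) (inj₁ (p , q)) →
                   inj₁ (≈-trans G (≈-sym G a) (≈-trans G p c) , ∼-resp H b d q)
               ; (a , b) (c , d) (inj₂ (p , q)) →
                   inj₂ (∼-resp G a c p , ≈-trans H (≈-sym H b) (≈-trans H q d)) } }

_⊠_ : Graph → Graph → Graph
G ⊠ H = record
  { V = V G × V H
  ; _≈_ = _≈×_ G H
  ; isEquivalence = ≈×-isEquivalence G H
  ; _∼_ = λ (g , h) (g′ , h′) → _∼_ G g g′ × _∼_ H h h′
  ; ∼-refl = ∼-refl G , ∼-refl H
  ; ∼-sym = λ (p , q) → ∼-sym G p , ∼-sym H q
  ; ∼-resp = λ (a , b) (c , d) (p , q) → ∼-resp G a c p , ∼-resp H b d q }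

private
  ≈⇒∼ : ∀ G {x y} → _≈_ G x y → _∼_ G x y
  ≈⇒∼ G p = ∼-resp G (≈-refl G) p (∼-refl G)


box-⊗₁ : ∀ {A B C D} → Hom A B → Hom C D → Hom (A □ C) (B □ D)
box-⊗₁ f g = record
  { fun = λ (x , y) → fun f x , fun g y
  ; fun-cong = λ (p , q) → fun-cong f p , fun-cong g q
  ; fun-∼ = λ { (inj₁ (p , q)) → inj₁ (fun-cong f p , fun-∼ g q)
              ; (inj₂ (p , q)) → inj₂ (fun-∼ f p , fun-cong g q) } }

box-α : ∀ A B C → Iso ((A □ B) □ C) (A □ (B □ C))
box-α A B C = record
  { to = record
    { fun = λ ((a , b) , c) → a , (b , c)
    ; fun-cong = λ ((p , q) , r) → p , (q , r)
    ; fun-∼ = λ { (inj₁ ((p , q) , r)) → inj₁ (p , inj₁ (q , r))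
                ; (inj₂ (inj₁ (p , q) , r)) → inj₁ (p , inj₂ (q , r))
                ; (inj₂ (inj₂ (p , q) , r)) → inj₂ (p , (q , r)) } }
  ; from = record
    { fun = λ (a , (b , c)) → (a , b) , c
    ; fun-cong = λ (p , (q , r)) → (p , q) , r
    ; fun-∼ = λ { (inj₁ (p , inj₁ (q , r))) → inj₁ ((p , q) , r)
                ; (inj₁ (p , inj₂ (q , r))) → inj₂ (inj₁ (p , q) , r)
                ; (inj₂ (p , (q , r))) → inj₂ (inj₂ (p , q) , r) } }
  ; to∘from = λ _ → ≈-refl (A □ (B □ C))
  ; from∘to = λ _ → ≈-refl ((A □ B) □ C) }

box-λ : ∀ A → Iso (K₁ □ A) A
box-λ A = record
  { to = record
    { fun = proj₂ ; fun-cong = proj₂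
    ; fun-∼ = λ { (inj₁ (_ , q)) → q ; (inj₂ (_ , q)) → ≈⇒∼ A q } }
  ; from = record
    { fun = λ a → tt , a ; fun-cong = λ p → tt , p ; fun-∼ = λ p → inj₁ (tt , p) }
  ; to∘from = λ _ → ≈-refl A
  ; from∘to = λ _ → ≈-refl (K₁ □ A) }

box-ρ : ∀ A → Iso (A □ K₁) A
box-ρ A = record
  { to = record
    { fun = proj₁ ; fun-cong = proj₁
    ; fun-∼ = λ { (inj₁ (p , _)) → ≈⇒∼ A p ; (inj₂ (p , _)) → p } }
  ; from = record
    { fun = λ a → a , tt ; fun-cong = λ p → p , tt ; fun-∼ = λ p → inj₂ (p , tt) }
  ; to∘from = λ _ → ≈-refl A
  ; from∘to = λ _ → ≈-refl (A □ K₁) }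

Box : Monoidal
Box = record
  { _⊗₀_ = _□_
  ; _⊗₁_ = box-⊗₁
  ; ⊗-resp = λ p q (x , y) → p x , q y
  ; ⊗-id = λ {A} {C} _ → ≈-refl (A □ C)
  ; ⊗-∘ = λ {A} {B} {B′} {C} {D} {D′} _ _ _ _ _ → ≈-refl (B′ □ D′)
  ; unit = K₁
  ; α = box-α
  ; λ≅ = box-λ
  ; ρ≅ = box-ρ
  ; α-nat = λ {A} {A′} {B} {B′} {C} {C′} _ _ _ _ → ≈-refl (A′ □ (B′ □ C′))
  ; λ-nat = λ {A} {A′} _ _ → ≈-refl A′
  ; ρ-nat = λ {A} {A′} _ _ → ≈-refl A′
  ; pentagon = λ A B C D _ → ≈-refl (A □ (B □ (C □ D)))
  ; triangle = λ A B _ → ≈-refl (A □ B) }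

cat-⊗₁ : ∀ {A B C D} → Hom A B → Hom C D → Hom (A ⊠ C) (B ⊠ D)
cat-⊗₁ f g = record
  { fun = λ (x , y) → fun f x , fun g y
  ; fun-cong = λ (p , q) → fun-cong f p , fun-cong g q
  ; fun-∼ = λ (p , q) → fun-∼ f p , fun-∼ g q }

cat-α : ∀ A B C → Iso ((A ⊠ B) ⊠ C) (A ⊠ (B ⊠ C))
cat-α A B C = record
  { to = record
    { fun = λ ((a , b) , c) → a , (b , c)
    ; fun-cong = λ ((p , q) , r) → p , (q , r)
    ; fun-∼ = λ ((p , q) , r) → p , (q , r) }
  ; from = record
    { fun = λ (a , (b , c)) → (a , b) , c
    ; fun-cong = λ (p , (q , r)) → (p , q) , r
    ; fun-∼ = λ (p , (q , r)) → (p , q) , r }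
  ; to∘from = λ _ → ≈-refl (A ⊠ (B ⊠ C))
  ; from∘to = λ _ → ≈-refl ((A ⊠ B) ⊠ C) }

cat-λ : ∀ A → Iso (K₁ ⊠ A) A
cat-λ A = record
  { to = record { fun = proj₂ ; fun-cong = proj₂ ; fun-∼ = proj₂ }
  ; from = record
    { fun = λ a → tt , a ; fun-cong = λ p → tt , p ; fun-∼ = λ p → tt , p }
  ; to∘from = λ _ → ≈-refl A
  ; from∘to = λ _ → ≈-refl (K₁ ⊠ A) }

cat-ρ : ∀ A → Iso (A ⊠ K₁) A
cat-ρ A = record
  { to = record { fun = proj₁ ; fun-cong = proj₁ ; fun-∼ = proj₁ }
  ; from = record
    { fun = λ a → a , tt ; fun-cong = λ p → p , tt ; fun-∼ = λ p → p , tt }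
  ; to∘from = λ _ → ≈-refl A
  ; from∘to = λ _ → ≈-refl (A ⊠ K₁) }

Cat : Monoidal
Cat = record
  { _⊗₀_ = _⊠_
  ; _⊗₁_ = cat-⊗₁
  ; ⊗-resp = λ p q (x , y) → p x , q y
  ; ⊗-id = λ {A} {C} _ → ≈-refl (A ⊠ C)
  ; ⊗-∘ = λ {A} {B} {B′} {C} {D} {D′} _ _ _ _ _ → ≈-refl (B′ ⊠ D′)
  ; unit = K₁
  ; α = cat-α
  ; λ≅ = cat-λ
  ; ρ≅ = cat-ρ
  ; α-nat = λ {A} {A′} {B} {B′} {C} {C′} _ _ _ _ → ≈-refl (A′ ⊠ (B′ ⊠ C′))
  ; λ-nat = λ {A} {A′} _ _ → ≈-refl A′
  ; ρ-nat = λ {A} {A′} _ _ → ≈-refl A′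
  ; pentagon = λ A B C D _ → ≈-refl (A ⊠ (B ⊠ (C ⊠ D)))
  ; triangle = λ A B _ → ≈-refl (A ⊠ B) }

{-# OPTIONS --safe #-}
-- Both X ⊗ - and - ⊗ X are left adjoints, so a map out of G ⊗ H is determined by its
-- restrictions along the slices idH ⊗ point h and point g ⊗ idH; comparing indicator maps
-- into the complete graph K₂ turns this into the statement that the slices cover G ⊗ H (this
-- is where excluded middle enters).  Hence the unit and K₁ ⊗ K₁ are single vertices, and
-- pair g h = (point g ⊗ point h) p₀ is a bijection V G × V H → V (G ⊗ H) whose inverse is
-- given by the projections built from the unitors.  The slices through a vertex are images of
-- G and H, so every box edge is an edge of G ⊗ H; the projections are graph maps, so every
-- edge of G ⊗ H is an edge of G ⊠ H.  Which extreme occurs is decided by K₂ ⊗ K₂: if it has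
-- the diagonal edge, every product edge is an image of it; if not, an edge of G ⊗ H changing
-- both coordinates cannot exist, since indicator maps would send it onto that diagonal.

module Submission where

open import Defs
open import Level using (0ℓ; suc; lift; lower)
open import Data.Bool using (Bool; true; false)
open import Data.Empty using (⊥-elim)
open import Data.Product using (_×_; _,_; proj₁; Σ-syntax)
open import Data.Sum using (_⊎_; inj₁; inj₂)
open import Data.Unit using (⊤; tt)
open import Function.Bundles using (mk⇔)
open import Relation.Binary using (Setoid)
open import Relation.Binary.PropositionalEquality as ≡ using (_≡_; refl)
open import Relation.Binary.Reasoning.MultiSetoid
open import Relation.Nullary using (Dec; yes; no; ¬_; does)
open import Relation.Nullary.Decidable using (map′; dec-true; dec-false; does-⇔)
open import Axiom.ExcludedMiddle using (ExcludedMiddle)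

open Graph
open Hom
open Iso

setoid : Graph → Setoid 0ℓ 0ℓ
setoid G = record { Carrier = V G ; _≈_ = _≈_ G ; isEquivalence = isEquivalence G }

Hom-setoid : Graph → Graph → Setoid 0ℓ 0ℓ
Hom-setoid G H = record
  { Carrier = Hom G H
  ; _≈_ = _≗_
  ; isEquivalence = record
    { refl = λ _ → ≈-refl H
    ; sym = λ p x → ≈-sym H (p x)
    ; trans = λ p q x → ≈-trans H (p x) (q x) } }

lowerExcludedMiddle : ExcludedMiddle (suc 0ℓ) → ExcludedMiddle 0ℓ
lowerExcludedMiddle em = map′ lower lift em

K₂ : Graph
K₂ = record
  { V = Bool
  ; _≈_ = _≡_
  ; isEquivalence = ≡.isEquivalence
  ; _∼_ = λ _ _ → ⊤
  ; ∼-refl = tt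
  ; ∼-sym = λ _ → tt
  ; ∼-resp = λ _ _ _ → tt }

const : ∀ {G H} → V H → Hom G H
const {H = H} h = record { fun = λ _ → h ; fun-cong = λ _ → ≈-refl H ; fun-∼ = λ _ → ∼-refl H }

point : ∀ {G} → V G → Hom K₁ G
point = const

! : ∀ {G} → Hom G K₁
! = const tt

edgeMap : ∀ {G x y} → _∼_ G x y → Hom K₂ G
edgeMap {G} {x} {y} e = record { fun = f ; fun-cong = λ { refl → ≈-refl G } ; fun-∼ = λ {a} {b} _ → f-∼ a b }
  where
    f : Bool → V G
    f false = x
    f true  = y

    f-∼ : ∀ a b → _∼_ G (f a) (f b)
    f-∼ false false = ∼-refl G
    f-∼ false true  = e
    f-∼ true  false = ∼-sym G e
    f-∼ true  true  = ∼-refl G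

indicator : ∀ {G} (P : V G → Set) → (∀ {x y} → _≈_ G x y → P x → P y) → (∀ x → Dec (P x)) → Hom G K₂
indicator {G} P resp P? = record
  { fun = λ x → does (P? x)
  ; fun-cong = λ x≈y → does-⇔ (mk⇔ (resp x≈y) (resp (≈-sym G x≈y))) (P? _) (P? _)
  ; fun-∼ = λ _ → tt }

Subsingleton : Graph → Set
Subsingleton G = ∀ x y → _≈_ G x y

retract-subsingleton : ∀ {G H} (s : Hom G H) (r : Hom H G) → r ∘H s ≗ idH → Subsingleton H → Subsingleton G
retract-subsingleton {G} s r rs≗id H-sub x y = begin⟨ setoid G ⟩
  x               ≈⟨ rs≗id x ⟨
  fun r (fun s x) ≈⟨ fun-cong r (H-sub _ _) ⟩
  fun r (fun s y) ≈⟨ rs≗id y ⟩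
  y               ∎

-- A vertex outside the union of the images is detected by the indicator of that union.
jointlyEpic⇒jointlySurjective :
  ExcludedMiddle 0ℓ → ∀ {I : Set} {A G} (f : I → Hom A G) →
  ((u v : Hom G K₂) → (∀ i → u ∘H f i ≗ v ∘H f i) → u ≗ v) →
  ∀ x → Σ[ i ∈ I ] Σ[ a ∈ V A ] _≈_ G x (fun (f i) a)
jointlyEpic⇒jointlySurjective em {I} {A} {G} f epic x =
  witness em (epic (indicator InImage resp (λ _ → em)) (const true) inImage x)
  where
    InImage : V G → Set
    InImage x = Σ[ i ∈ I ] Σ[ a ∈ V A ] _≈_ G x (fun (f i) a)

    resp : ∀ {x y} → _≈_ G x y → InImage x → InImage y
    resp x≈y (i , a , x≈fa) = i , a , ≈-trans G (≈-sym G x≈y) x≈fa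

    inImage : ∀ i a → does (em {InImage (fun (f i) a)}) ≡ true
    inImage i a = dec-true em (i , a , ≈-refl G)

    witness : (d : Dec (InImage x)) → does d ≡ true → InImage x
    witness (yes p) _ = p

_⇒□_ : Graph → Graph → Graph
X ⇒□ B = record
  { V = Hom X B
  ; _≈_ = _≗_
  ; isEquivalence = Setoid.isEquivalence (Hom-setoid X B)
  ; _∼_ = λ f g → ∀ x → _∼_ B (fun f x) (fun g x)
  ; ∼-refl = λ _ → ∼-refl B
  ; ∼-sym = λ f∼g x → ∼-sym B (f∼g x)
  ; ∼-resp = λ f≈f′ g≈g′ f∼g x → ∼-resp B (f≈f′ x) (g≈g′ x) (f∼g x) }

_⇒⊠_ : Graph → Graph → Graph
X ⇒⊠ B = record (X ⇒□ B)
  { _∼_ = λ f g → ∀ {x x′} → _∼_ X x x′ → _∼_ B (fun f x) (fun g x′)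
  ; ∼-refl = λ {f} → fun-∼ f
  ; ∼-sym = λ f∼g x∼x′ → ∼-sym B (f∼g (∼-sym X x∼x′))
  ; ∼-resp = λ f≈f′ g≈g′ f∼g x∼x′ → ∼-resp B (f≈f′ _) (g≈g′ _) (f∼g x∼x′) }

Box-biclosed : Biclosed Box
Box-biclosed = record
  { [_⊸_] = _⇒□_
  ; evˡ = λ X B → record
    { fun = λ (x , f) → fun f x
    ; fun-cong = λ { {_ , f} {x′ , _} (x≈x′ , f≈g) → ≈-trans B (fun-cong f x≈x′) (f≈g x′) }
    ; fun-∼ = λ
      { {x , _} {_ , g} (inj₁ (x≈x′ , f∼g)) → ∼-resp B (≈-refl B) (fun-cong g x≈x′) (f∼g x)
      ; {_ , f} {x′ , _} (inj₂ (x∼x′ , f≈g)) → ∼-resp B (≈-refl B) (f≈g x′) (fun-∼ f x∼x′) } }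
  ; curryˡ = λ {X} {A} f → record
    { fun = λ a → record
      { fun = λ x → fun f (x , a)
      ; fun-cong = λ x≈x′ → fun-cong f (x≈x′ , ≈-refl A)
      ; fun-∼ = λ x∼x′ → fun-∼ f (inj₂ (x∼x′ , ≈-refl A)) }
    ; fun-cong = λ a≈a′ x → fun-cong f (≈-refl X , a≈a′)
    ; fun-∼ = λ a∼a′ x → fun-∼ f (inj₁ (≈-refl X , a∼a′)) }
  ; curryˡ-β = λ {B = B} _ _ → ≈-refl B
  ; curryˡ-unique = λ _ _ β a x → β (x , a)
  ; [_⟜_] = λ B X → X ⇒□ B
  ; evʳ = λ X B → record
    { fun = λ (f , x) → fun f x
    ; fun-cong = λ { {f , _} {_ , x′} (f≈g , x≈x′) → ≈-trans B (fun-cong f x≈x′) (f≈g x′) }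
    ; fun-∼ = λ
      { {f , _} {_ , x′} (inj₁ (f≈g , x∼x′)) → ∼-resp B (≈-refl B) (f≈g x′) (fun-∼ f x∼x′)
      ; {_ , x} {g , _} (inj₂ (f∼g , x≈x′)) → ∼-resp B (≈-refl B) (fun-cong g x≈x′) (f∼g x) } }
  ; curryʳ = λ {X} {A} f → record
    { fun = λ a → record
      { fun = λ x → fun f (a , x)
      ; fun-cong = λ x≈x′ → fun-cong f (≈-refl A , x≈x′)
      ; fun-∼ = λ x∼x′ → fun-∼ f (inj₁ (≈-refl A , x∼x′)) }
    ; fun-cong = λ a≈a′ x → fun-cong f (a≈a′ , ≈-refl X)
    ; fun-∼ = λ a∼a′ x → fun-∼ f (inj₂ (a∼a′ , ≈-refl X)) }
  ; curryʳ-β = λ {B = B} _ _ → ≈-refl B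
  ; curryʳ-unique = λ _ _ β a x → β (a , x) }

Cat-biclosed : Biclosed Cat
Cat-biclosed = record
  { [_⊸_] = _⇒⊠_
  ; evˡ = λ X B → record
    { fun = λ (x , f) → fun f x
    ; fun-cong = λ { {_ , f} {x′ , _} (x≈x′ , f≈g) → ≈-trans B (fun-cong f x≈x′) (f≈g x′) }
    ; fun-∼ = λ (x∼x′ , f∼g) → f∼g x∼x′ }
  ; curryˡ = λ {X} {A} f → record
    { fun = λ a → record
      { fun = λ x → fun f (x , a)
      ; fun-cong = λ x≈x′ → fun-cong f (x≈x′ , ≈-refl A)
      ; fun-∼ = λ x∼x′ → fun-∼ f (x∼x′ , ∼-refl A) }
    ; fun-cong = λ a≈a′ x → fun-cong f (≈-refl X , a≈a′)
    ; fun-∼ = λ a∼a′ x∼x′ → fun-∼ f (x∼x′ , a∼a′) }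
  ; curryˡ-β = λ {B = B} _ _ → ≈-refl B
  ; curryˡ-unique = λ _ _ β a x → β (x , a)
  ; [_⟜_] = λ B X → X ⇒⊠ B
  ; evʳ = λ X B → record
    { fun = λ (f , x) → fun f x
    ; fun-cong = λ { {f , _} {_ , x′} (f≈g , x≈x′) → ≈-trans B (fun-cong f x≈x′) (f≈g x′) }
    ; fun-∼ = λ (f∼g , x∼x′) → f∼g x∼x′ }
  ; curryʳ = λ {X} {A} f → record
    { fun = λ a → record
      { fun = λ x → fun f (a , x)
      ; fun-cong = λ x≈x′ → fun-cong f (≈-refl A , x≈x′)
      ; fun-∼ = λ x∼x′ → fun-∼ f (∼-refl A , x∼x′) }
    ; fun-cong = λ a≈a′ x → fun-cong f (a≈a′ , ≈-refl X)
    ; fun-∼ = λ a∼a′ x∼x′ → fun-∼ f (a∼a′ , x∼x′) }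
  ; curryʳ-β = λ {B = B} _ _ → ≈-refl B
  ; curryʳ-unique = λ _ _ β a x → β (a , x) }

record LeftAdjoint : Set₁ where
  field
    F₀           : Graph → Graph
    F₁           : ∀ {A B} → Hom A B → Hom (F₀ A) (F₀ B)
    F-resp       : ∀ {A B} {f g : Hom A B} → f ≗ g → F₁ f ≗ F₁ g
    F-∘          : ∀ {A B C} (f : Hom B C) (g : Hom A B) → F₁ (f ∘H g) ≗ F₁ f ∘H F₁ g
    R            : Graph → Graph
    ev           : ∀ B → Hom (F₀ (R B)) B
    curry        : ∀ {A B} → Hom (F₀ A) B → Hom A (R B)
    curry-β      : ∀ {A B} (f : Hom (F₀ A) B) → ev B ∘H F₁ (curry f) ≗ f
    curry-unique : ∀ {A B} (f : Hom (F₀ A) B) (g : Hom A (R B)) → ev B ∘H F₁ g ≗ f → g ≗ curry f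

  curry-resp : ∀ {A B} {f f′ : Hom (F₀ A) B} → f ≗ f′ → curry f ≗ curry f′
  curry-resp {B = B} {f} {f′} f≗f′ = curry-unique f′ (curry f) (λ w → ≈-trans B (curry-β f w) (f≗f′ w))

  curry-natural : ∀ {A A′ B} (f : Hom (F₀ A) B) (h : Hom A′ A) → curry f ∘H h ≗ curry (f ∘H F₁ h)
  curry-natural {B = B} f h = curry-unique (f ∘H F₁ h) (curry f ∘H h) λ w →
    ≈-trans B (fun-cong (ev B) (F-∘ (curry f) h w)) (curry-β f (fun (F₁ h) w))

  curry-determined-by-points : ∀ {H B} (f g : Hom (F₀ H) B) →
                               (∀ h → f ∘H F₁ (point h) ≗ g ∘H F₁ (point h)) → curry f ≗ curry g
  curry-determined-by-points {B = B} f g agree h = begin⟨ setoid (R B) ⟩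
    fun (curry f ∘H point h) tt        ≈⟨ curry-natural f (point h) tt ⟩
    fun (curry (f ∘H F₁ (point h))) tt ≈⟨ curry-resp (agree h) tt ⟩
    fun (curry (g ∘H F₁ (point h))) tt ≈⟨ curry-natural g (point h) tt ⟨
    fun (curry g ∘H point h) tt        ∎

  determined-by-points : ∀ {H B} (f g : Hom (F₀ H) B) →
                         (∀ h → f ∘H F₁ (point h) ≗ g ∘H F₁ (point h)) → f ≗ g
  determined-by-points {B = B} f g agree w = begin⟨ setoid B ⟩
    fun f w                      ≈⟨ curry-β f w ⟨
    fun (ev B ∘H F₁ (curry f)) w ≈⟨ fun-cong (ev B) (F-resp (curry-determined-by-points f g agree) w) ⟩
    fun (ev B ∘H F₁ (curry g)) w ≈⟨ curry-β g w ⟩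
    fun g w                      ∎

  covered-by-points : ExcludedMiddle 0ℓ → ∀ {H} (w : V (F₀ H)) →
                      Σ[ h ∈ V H ] Σ[ u ∈ V (F₀ K₁) ] _≈_ (F₀ H) w (fun (F₁ (point h)) u)
  covered-by-points em = jointlyEpic⇒jointlySurjective em (λ h → F₁ (point h)) determined-by-points

module _ {M : Monoidal} (C : Biclosed M) where
  open Monoidal M
  open Biclosed C

  tensorˡ : Graph → LeftAdjoint
  tensorˡ X = record
    { F₀ = X ⊗₀_
    ; F₁ = idH ⊗₁_
    ; F-resp = ⊗-resp (λ _ → ≈-refl X)
    ; F-∘ = ⊗-∘ idH idH
    ; R = λ B → [ X ⊸ B ]
    ; ev = evˡ X
    ; curry = curryˡ
    ; curry-β = curryˡ-β
    ; curry-unique = curryˡ-unique }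

  tensorʳ : Graph → LeftAdjoint
  tensorʳ X = record
    { F₀ = _⊗₀ X
    ; F₁ = _⊗₁ idH
    ; F-resp = λ f≗g → ⊗-resp f≗g (λ _ → ≈-refl X)
    ; F-∘ = λ f g → ⊗-∘ f g idH idH
    ; R = λ B → [ B ⟜ X ]
    ; ev = λ B → evʳ X B
    ; curry = curryʳ
    ; curry-β = curryʳ-β
    ; curry-unique = curryʳ-unique }

module Classification (em : ExcludedMiddle 0ℓ) (M : Monoidal) (C : Biclosed M) where
  open Monoidal M

  coverˡ : ∀ {G H} (w : V (G ⊗₀ H)) →
           Σ[ h ∈ V H ] Σ[ u ∈ V (G ⊗₀ K₁) ] _≈_ (G ⊗₀ H) w (fun (idH ⊗₁ point h) u)
  coverˡ {G} = LeftAdjoint.covered-by-points (tensorˡ C G) em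

  coverʳ : ∀ {G H} (w : V (G ⊗₀ H)) →
           Σ[ g ∈ V G ] Σ[ u ∈ V (K₁ ⊗₀ H) ] _≈_ (G ⊗₀ H) w (fun (point g ⊗₁ idH) u)
  coverʳ {H = H} = LeftAdjoint.covered-by-points (tensorʳ C H) em

  -- unit ⊗ K₁ ≅ K₁ has a vertex, and it lies in some slice point g ⊗ K₁.
  x₀ : V unit
  x₀ = proj₁ (coverʳ (fun (from (λ≅ K₁)) tt))

  K₁⊗unit-subsingleton : Subsingleton (K₁ ⊗₀ unit)
  K₁⊗unit-subsingleton = retract-subsingleton (to (ρ≅ K₁)) (from (ρ≅ K₁)) (from∘to (ρ≅ K₁)) (λ _ _ → tt)

  unit⊗K₁-subsingleton : Subsingleton (unit ⊗₀ K₁)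
  unit⊗K₁-subsingleton = retract-subsingleton (to (λ≅ K₁)) (from (λ≅ K₁)) (from∘to (λ≅ K₁)) (λ _ _ → tt)

  K₁⊗K₁-subsingleton : Subsingleton (K₁ ⊗₀ K₁)
  K₁⊗K₁-subsingleton =
    retract-subsingleton (idH ⊗₁ const x₀) (idH ⊗₁ !) retraction K₁⊗unit-subsingleton
    where
      retraction : (idH ⊗₁ !) ∘H (idH ⊗₁ const x₀) ≗ idH
      retraction = begin⟨ Hom-setoid (K₁ ⊗₀ K₁) (K₁ ⊗₀ K₁) ⟩
        (idH ⊗₁ !) ∘H (idH ⊗₁ const x₀)    ≈⟨ ⊗-∘ idH idH ! (const x₀) ⟨
        idH {K₁} ⊗₁ (! {unit} ∘H const x₀) ≈⟨ ⊗-resp (λ _ → tt) (λ _ → tt) ⟩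
        idH ⊗₁ idH                         ≈⟨ ⊗-id ⟩
        idH                                ∎

  p₀ : V (K₁ ⊗₀ K₁)
  p₀ = fun (idH ⊗₁ !) (fun (from (ρ≅ K₁)) tt)

  pair : ∀ {G H} → V G → V H → V (G ⊗₀ H)
  pair g h = fun (point g ⊗₁ point h) p₀

  pair-cong : ∀ {G H g g′ h h′} → _≈_ G g g′ → _≈_ H h h′ → _≈_ (G ⊗₀ H) (pair g h) (pair g′ h′)
  pair-cong g≈g′ h≈h′ = ⊗-resp (λ _ → g≈g′) (λ _ → h≈h′) p₀

  pair-natural : ∀ {G G′ H H′} (f : Hom G G′) (k : Hom H H′) g h →
                 _≈_ (G′ ⊗₀ H′) (fun (f ⊗₁ k) (pair g h)) (pair (fun f g) (fun k h))
  pair-natural {G′ = G′} {H′ = H′} f k g h = begin⟨ setoid (G′ ⊗₀ H′) ⟩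
    fun (f ⊗₁ k) (pair g h)                     ≈⟨ ⊗-∘ f (point g) k (point h) p₀ ⟨
    fun ((f ∘H point g) ⊗₁ (k ∘H point h)) p₀   ≈⟨ ⊗-resp {f′ = point (fun f g)} {g′ = point (fun k h)}
                                                        (λ _ → ≈-refl G′) (λ _ → ≈-refl H′) p₀ ⟩
    pair (fun f g) (fun k h)                    ∎

  pair-surjective : ∀ {G H} (w : V (G ⊗₀ H)) → Σ[ g ∈ V G ] Σ[ h ∈ V H ] _≈_ (G ⊗₀ H) w (pair g h)
  pair-surjective {G} {H} w with coverˡ w
  ... | h , u , w≈ with coverʳ u
  ... | g , p , u≈ = g , h , (begin⟨ setoid (G ⊗₀ H) ⟩
    w
      ≈⟨ w≈ ⟩
    fun (idH ⊗₁ point h) u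
      ≈⟨ fun-cong (idH ⊗₁ point h) u≈ ⟩
    fun (idH ⊗₁ point h ∘H point g ⊗₁ idH) p
      ≈⟨ fun-cong (idH ⊗₁ point h ∘H point g ⊗₁ idH) (K₁⊗K₁-subsingleton p p₀) ⟩
    fun (idH ⊗₁ point h ∘H point g ⊗₁ idH) p₀
      ≈⟨ ⊗-∘ idH (point g) (point h) idH p₀ ⟨
    pair g h
      ∎)

  π₁ : ∀ {G H} → Hom (G ⊗₀ H) G
  π₁ {G} = to (ρ≅ G) ∘H (idH ⊗₁ const x₀)

  π₂ : ∀ {G H} → Hom (G ⊗₀ H) H
  π₂ {H = H} = to (λ≅ H) ∘H (const x₀ ⊗₁ idH)

  π₁-natural : ∀ {G G′ H H′} (f : Hom G G′) (k : Hom H H′) → π₁ ∘H (f ⊗₁ k) ≗ f ∘H π₁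
  π₁-natural {G′ = G′} f k w = begin⟨ setoid G′ ⟩
    fun (to (ρ≅ G′) ∘H (idH ⊗₁ const x₀) ∘H (f ⊗₁ k)) w
      ≈⟨ fun-cong (to (ρ≅ G′)) (⊗-∘ idH f (const x₀) k w) ⟨
    fun (to (ρ≅ G′) ∘H (f ⊗₁ const x₀)) w
      ≈⟨ fun-cong (to (ρ≅ G′)) (⊗-∘ f idH idH (const x₀) w) ⟩
    fun (to (ρ≅ G′) ∘H (f ⊗₁ idH)) (fun (idH ⊗₁ const x₀) w)
      ≈⟨ ρ-nat f _ ⟩
    fun f (fun π₁ w)
      ∎

  π₂-natural : ∀ {G G′ H H′} (f : Hom G G′) (k : Hom H H′) → π₂ ∘H (f ⊗₁ k) ≗ k ∘H π₂
  π₂-natural {H′ = H′} f k w = begin⟨ setoid H′ ⟩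
    fun (to (λ≅ H′) ∘H (const x₀ ⊗₁ idH) ∘H (f ⊗₁ k)) w
      ≈⟨ fun-cong (to (λ≅ H′)) (⊗-∘ (const x₀) f idH k w) ⟨
    fun (to (λ≅ H′) ∘H (const x₀ ⊗₁ k)) w
      ≈⟨ fun-cong (to (λ≅ H′)) (⊗-∘ idH (const x₀) k idH w) ⟩
    fun (to (λ≅ H′) ∘H (idH ⊗₁ k)) (fun (const x₀ ⊗₁ idH) w)
      ≈⟨ λ-nat k _ ⟩
    fun k (fun π₂ w)
      ∎

  π₁-pair : ∀ {G H} (g : V G) (h : V H) → _≈_ G (fun π₁ (pair g h)) g
  π₁-pair {G} {H} g h = π₁-natural (point {G} g) (point {H} h) p₀

  π₂-pair : ∀ {G H} (g : V G) (h : V H) → _≈_ H (fun π₂ (pair g h)) h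
  π₂-pair {G} {H} g h = π₂-natural (point {G} g) (point {H} h) p₀

  pair-η : ∀ {G H} (w : V (G ⊗₀ H)) → _≈_ (G ⊗₀ H) w (pair (fun π₁ w) (fun π₂ w))
  pair-η {G} {H} w = canonical (pair-surjective w)
    where
      canonical : Σ[ g ∈ V G ] Σ[ h ∈ V H ] _≈_ (G ⊗₀ H) w (pair g h) →
                  _≈_ (G ⊗₀ H) w (pair (fun π₁ w) (fun π₂ w))
      canonical (g , h , w≈) = begin⟨ setoid (G ⊗₀ H) ⟩
        w                                            ≈⟨ w≈ ⟩
        pair g h                                     ≈⟨ pair-cong (π₁-pair {G} {H} g h) (π₂-pair {G} {H} g h) ⟨
        pair (fun π₁ (pair g h)) (fun π₂ (pair g h)) ≈⟨ pair-cong (fun-cong π₁ w≈) (fun-cong π₂ w≈) ⟨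
        pair (fun π₁ w) (fun π₂ w)                   ∎

  pair-unitˡ-irrelevant : ∀ {H} (a a′ : V unit) (h : V H) → _≈_ (unit ⊗₀ H) (pair a h) (pair a′ h)
  pair-unitˡ-irrelevant {H} a a′ h = begin⟨ setoid (unit ⊗₀ H) ⟩
    pair a h                          ≈⟨ pair-natural idH (point h) a tt ⟨
    fun (idH ⊗₁ point h) (pair a tt)  ≈⟨ fun-cong (idH ⊗₁ point h) (unit⊗K₁-subsingleton _ _) ⟩
    fun (idH ⊗₁ point h) (pair a′ tt) ≈⟨ pair-natural idH (point h) a′ tt ⟩
    pair a′ h                         ∎

  pair-unitʳ-irrelevant : ∀ {G} (g : V G) (b b′ : V unit) → _≈_ (G ⊗₀ unit) (pair g b) (pair g b′)
  pair-unitʳ-irrelevant {G} g b b′ = begin⟨ setoid (G ⊗₀ unit) ⟩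
    pair g b                          ≈⟨ pair-natural (point g) idH tt b ⟨
    fun (point g ⊗₁ idH) (pair tt b)  ≈⟨ fun-cong (point g ⊗₁ idH) (K₁⊗unit-subsingleton _ _) ⟩
    fun (point g ⊗₁ idH) (pair tt b′) ≈⟨ pair-natural (point g) idH tt b′ ⟩
    pair g b′                         ∎

  unit-subsingleton : Subsingleton unit
  unit-subsingleton =
    retract-subsingleton (from (λ≅ unit)) (to (λ≅ unit)) (to∘from (λ≅ unit)) unit⊗unit-subsingleton
    where
      unit⊗unit-subsingleton : Subsingleton (unit ⊗₀ unit)
      unit⊗unit-subsingleton w w′ = begin⟨ setoid (unit ⊗₀ unit) ⟩
        w                             ≈⟨ pair-η w ⟩
        pair (fun π₁ w) (fun π₂ w)    ≈⟨ pair-unitˡ-irrelevant (fun π₁ w) (fun π₁ w′) (fun π₂ w) ⟩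
        pair (fun π₁ w′) (fun π₂ w)   ≈⟨ pair-unitʳ-irrelevant (fun π₁ w′) (fun π₂ w) (fun π₂ w′) ⟩
        pair (fun π₁ w′) (fun π₂ w′)  ≈⟨ pair-η w′ ⟨
        w′                            ∎

  unit≅K₁ : Iso unit K₁
  unit≅K₁ = record
    { to = !
    ; from = point x₀
    ; to∘from = λ _ → tt
    ; from∘to = unit-subsingleton x₀ }

  ⊗-subsingleton : ∀ {G H} → Subsingleton G → Subsingleton H → Subsingleton (G ⊗₀ H)
  ⊗-subsingleton {G} {H} G-sub H-sub w w′ = begin⟨ setoid (G ⊗₀ H) ⟩
    w                            ≈⟨ pair-η w ⟩
    pair (fun π₁ w) (fun π₂ w)   ≈⟨ pair-cong (G-sub _ _) (H-sub _ _) ⟩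
    pair (fun π₁ w′) (fun π₂ w′) ≈⟨ pair-η w′ ⟨
    w′                           ∎

  π₁≈ρ : ∀ {G} (w : V (G ⊗₀ unit)) → _≈_ G (fun π₁ w) (fun (to (ρ≅ G)) w)
  π₁≈ρ {G} w = fun-cong (to (ρ≅ G)) (≈-trans (G ⊗₀ unit)
    (⊗-resp {f′ = idH} {g′ = idH} (λ _ → ≈-refl G) (λ _ → unit-subsingleton _ _) w) (⊗-id w))

  π₂≈λ : ∀ {H} (w : V (unit ⊗₀ H)) → _≈_ H (fun π₂ w) (fun (to (λ≅ H)) w)
  π₂≈λ {H} w = fun-cong (to (λ≅ H)) (≈-trans (unit ⊗₀ H)
    (⊗-resp {f′ = idH} {g′ = idH} (λ _ → unit-subsingleton _ _) (λ _ → ≈-refl H) w) (⊗-id w))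

  ρ⁻¹-pair : ∀ {G} (g : V G) → _≈_ (G ⊗₀ unit) (fun (from (ρ≅ G)) g) (pair g x₀)
  ρ⁻¹-pair {G} g = ≈-trans (G ⊗₀ unit) (pair-η _)
    (pair-cong (≈-trans G (π₁≈ρ {G} _) (to∘from (ρ≅ G) g)) (unit-subsingleton _ _))

  λ⁻¹-pair : ∀ {H} (h : V H) → _≈_ (unit ⊗₀ H) (fun (from (λ≅ H)) h) (pair x₀ h)
  λ⁻¹-pair {H} h = ≈-trans (unit ⊗₀ H) (pair-η _)
    (pair-cong (unit-subsingleton _ _) (≈-trans H (π₂≈λ {H} _) (to∘from (λ≅ H) h)))

  pair-∼ˡ : ∀ {G H g g′} (h : V H) → _∼_ G g g′ → _∼_ (G ⊗₀ H) (pair g h) (pair g′ h)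
  pair-∼ˡ {G} {H} h e = ∼-resp (G ⊗₀ H) (slice _) (slice _) (fun-∼ sliceMap e)
    where
      sliceMap : Hom G (G ⊗₀ H)
      sliceMap = (idH ⊗₁ const h) ∘H from (ρ≅ G)

      slice : ∀ g → _≈_ (G ⊗₀ H) (fun sliceMap g) (pair g h)
      slice g = ≈-trans (G ⊗₀ H) (fun-cong (idH ⊗₁ const h) (ρ⁻¹-pair g))
                  (pair-natural idH (const h) g x₀)

  pair-∼ʳ : ∀ {G H h h′} (g : V G) → _∼_ H h h′ → _∼_ (G ⊗₀ H) (pair g h) (pair g h′)
  pair-∼ʳ {G} {H} g e = ∼-resp (G ⊗₀ H) (slice _) (slice _) (fun-∼ sliceMap e)
    where
      sliceMap : Hom H (G ⊗₀ H)
      sliceMap = (const g ⊗₁ idH) ∘H from (λ≅ H)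

      slice : ∀ h → _≈_ (G ⊗₀ H) (fun sliceMap h) (pair g h)
      slice h = ≈-trans (G ⊗₀ H) (fun-cong (const g ⊗₁ idH) (λ⁻¹-pair h))
                  (pair-natural (const g) idH x₀ h)

  split : ∀ {G H} → V (G ⊗₀ H) → V G × V H
  split w = fun π₁ w , fun π₂ w

  pair-□ : ∀ {G H} → Hom (G □ H) (G ⊗₀ H)
  pair-□ {G} {H} = record
    { fun = λ (g , h) → pair g h
    ; fun-cong = λ (g≈g′ , h≈h′) → pair-cong g≈g′ h≈h′
    ; fun-∼ = λ
      { (inj₁ (g≈g′ , h∼h′)) →
          ∼-resp (G ⊗₀ H) (≈-refl (G ⊗₀ H)) (pair-cong g≈g′ (≈-refl H)) (pair-∼ʳ _ h∼h′)
      ; (inj₂ (g∼g′ , h≈h′)) →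
          ∼-resp (G ⊗₀ H) (≈-refl (G ⊗₀ H)) (pair-cong (≈-refl G) h≈h′) (pair-∼ˡ _ g∼g′) } }

  split-⊠ : ∀ {G H} → Hom (G ⊗₀ H) (G ⊠ H)
  split-⊠ = record
    { fun = split
    ; fun-cong = λ w≈w′ → fun-cong π₁ w≈w′ , fun-cong π₂ w≈w′
    ; fun-∼ = λ w∼w′ → fun-∼ π₁ w∼w′ , fun-∼ π₂ w∼w′ }

  HasDiagonal : Set
  HasDiagonal = _∼_ (K₂ ⊗₀ K₂) (pair false false) (pair true true)

  pair-⊠ : HasDiagonal → ∀ {G H} → Hom (G ⊠ H) (G ⊗₀ H)
  pair-⊠ diagonal {G} {H} = record
    { fun = λ (g , h) → pair g h
    ; fun-cong = λ (g≈g′ , h≈h′) → pair-cong g≈g′ h≈h′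
    ; fun-∼ = λ (e , e′) → ∼-resp (G ⊗₀ H)
        (pair-natural (edgeMap e) (edgeMap e′) false false)
        (pair-natural (edgeMap e) (edgeMap e′) true true)
        (fun-∼ (edgeMap e ⊗₁ edgeMap e′) diagonal) }

  ⊗₁-split : ∀ {G G′ H H′} (f : Hom G G′) (k : Hom H H′) (w : V (G ⊗₀ H)) →
             _≈_ (G′ ⊗₀ H′) (fun (f ⊗₁ k) w) (pair (fun f (fun π₁ w)) (fun k (fun π₂ w)))
  ⊗₁-split {G′ = G′} {H′ = H′} f k w =
    ≈-trans (G′ ⊗₀ H′) (fun-cong (f ⊗₁ k) (pair-η w)) (pair-natural f k _ _)

  χ : ∀ {G} → V G → Hom G K₂
  χ {G} a = indicator (λ x → _≈_ G x a) (λ x≈y x≈a → ≈-trans G (≈-sym G x≈y) x≈a) (λ _ → em)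

  -- χ (π₁ w′) ⊗ χ (π₂ w′) sends w to pair false false and w′ to pair true true.
  diagonal-of-edge : ∀ {G H w w′} → _∼_ (G ⊗₀ H) w w′ →
                     ¬ _≈_ G (fun π₁ w) (fun π₁ w′) → ¬ _≈_ H (fun π₂ w) (fun π₂ w′) → HasDiagonal
  diagonal-of-edge {G} {H} {w} {w′} e π₁≉ π₂≉ = ∼-resp (K₂ ⊗₀ K₂)
    (≈-trans (K₂ ⊗₀ K₂) (⊗₁-split χ₁ χ₂ w) (pair-cong (dec-false em π₁≉) (dec-false em π₂≉)))
    (≈-trans (K₂ ⊗₀ K₂) (⊗₁-split χ₁ χ₂ w′)
      (pair-cong (dec-true em (≈-refl G)) (dec-true em (≈-refl H))))
    (fun-∼ (χ₁ ⊗₁ χ₂) e)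
    where
      χ₁ = χ (fun π₁ w′)
      χ₂ = χ (fun π₂ w′)

  split-□ : ¬ HasDiagonal → ∀ {G H} → Hom (G ⊗₀ H) (G □ H)
  split-□ ¬diagonal {G} {H} = record
    { fun = split
    ; fun-cong = λ w≈w′ → fun-cong π₁ w≈w′ , fun-cong π₂ w≈w′
    ; fun-∼ = box-edge }
    where
      box-edge : ∀ {w w′} → _∼_ (G ⊗₀ H) w w′ → _∼_ (G □ H) (split w) (split w′)
      box-edge {w} {w′} e = cases em em
        where
          cases : Dec (_≈_ G (fun π₁ w) (fun π₁ w′)) → Dec (_≈_ H (fun π₂ w) (fun π₂ w′)) →
                  _∼_ (G □ H) (split w) (split w′)
          cases (yes π₁≈) _         = inj₁ (π₁≈ , fun-∼ π₂ e)
          cases (no _)    (yes π₂≈) = inj₂ (fun-∼ π₁ e , π₂≈)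
          cases (no π₁≉)  (no π₂≉)  = ⊥-elim (¬diagonal (diagonal-of-edge e π₁≉ π₂≉))

  α-pair : ∀ {A B C} (a : V A) (b : V B) (c : V C) →
           _≈_ (A ⊗₀ (B ⊗₀ C)) (fun (to (α A B C)) (pair (pair a b) c)) (pair a (pair b c))
  α-pair {A} {B} {C} a b c = begin⟨ setoid (A ⊗₀ (B ⊗₀ C)) ⟩
    fun (to (α A B C)) (pair (pair a b) c)
      ≈⟨ fun-cong (to (α A B C)) (pair-natural (point a ⊗₁ point b) (point c) p₀ tt) ⟨
    fun (to (α A B C) ∘H ((point a ⊗₁ point b) ⊗₁ point c)) (pair p₀ tt)
      ≈⟨ α-nat (point a) (point b) (point c) (pair p₀ tt) ⟩
    fun (point a ⊗₁ (point b ⊗₁ point c)) (fun (to (α K₁ K₁ K₁)) (pair p₀ tt))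
      ≈⟨ fun-cong (point a ⊗₁ (point b ⊗₁ point c)) (⊗-subsingleton (λ _ _ → tt) K₁⊗K₁-subsingleton _ _) ⟩
    fun (point a ⊗₁ (point b ⊗₁ point c)) (pair tt p₀)
      ≈⟨ pair-natural (point a) (point b ⊗₁ point c) tt p₀ ⟩
    pair a (pair b c)
      ∎

  split-α : ∀ {A B C} (w : V ((A ⊗₀ B) ⊗₀ C)) → let v = fun (to (α A B C)) w in
            _≈_ A (fun π₁ (fun π₁ w)) (fun π₁ v) ×
            _≈_ B (fun π₂ (fun π₁ w)) (fun π₁ (fun π₂ v)) ×
            _≈_ C (fun π₂ w) (fun π₂ (fun π₂ v))
  split-α {A} {B} {C} w =
      ≈-sym A (≈-trans A (fun-cong π₁ v≈) (π₁-pair {A} {B ⊗₀ C} a (pair b c)))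
    , ≈-sym B (≈-trans B (fun-cong π₁ π₂v≈) (π₁-pair {B} {C} b c))
    , ≈-sym C (≈-trans C (fun-cong π₂ π₂v≈) (π₂-pair {B} {C} b c))
    where
      a = fun π₁ (fun π₁ w)
      b = fun π₂ (fun π₁ w)
      c = fun π₂ w

      w≈ : _≈_ ((A ⊗₀ B) ⊗₀ C) w (pair (pair a b) c)
      w≈ = ≈-trans ((A ⊗₀ B) ⊗₀ C) (pair-η w) (pair-cong (pair-η (fun π₁ w)) (≈-refl C))

      v≈ : _≈_ (A ⊗₀ (B ⊗₀ C)) (fun (to (α A B C)) w) (pair a (pair b c))
      v≈ = ≈-trans (A ⊗₀ (B ⊗₀ C)) (fun-cong (to (α A B C)) w≈) (α-pair a b c)

      π₂v≈ : _≈_ (B ⊗₀ C) (fun π₂ (fun (to (α A B C)) w)) (pair b c)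
      π₂v≈ = ≈-trans (B ⊗₀ C) (fun-cong π₂ v≈) (π₂-pair {A} {B ⊗₀ C} a (pair b c))

  □-iso : ¬ HasDiagonal → ∀ G H → Iso (G ⊗₀ H) (G □ H)
  □-iso ¬diagonal G H = record
    { to = split-□ ¬diagonal
    ; from = pair-□
    ; to∘from = λ (g , h) → π₁-pair {G} {H} g h , π₂-pair {G} {H} g h
    ; from∘to = λ w → ≈-sym (G ⊗₀ H) (pair-η w) }

  ⊠-iso : HasDiagonal → ∀ G H → Iso (G ⊗₀ H) (G ⊠ H)
  ⊠-iso diagonal G H = record
    { to = split-⊠
    ; from = pair-⊠ diagonal
    ; to∘from = λ (g , h) → π₁-pair {G} {H} g h , π₂-pair {G} {H} g h
    ; from∘to = λ w → ≈-sym (G ⊗₀ H) (pair-η w) }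

  Box-iso : ¬ HasDiagonal → MonoidalIso M Box
  Box-iso ¬diagonal = record
    { φ = □-iso ¬diagonal
    ; φ-nat = λ f k w → π₁-natural f k w , π₂-natural f k w
    ; ψ = unit≅K₁
    ; φ-α = λ _ _ _ → split-α
    ; φ-λ = λ _ → π₂≈λ
    ; φ-ρ = λ _ → π₁≈ρ }

  Cat-iso : HasDiagonal → MonoidalIso M Cat
  Cat-iso diagonal = record
    { φ = ⊠-iso diagonal
    ; φ-nat = λ f k w → π₁-natural f k w , π₂-natural f k w
    ; ψ = unit≅K₁
    ; φ-α = λ _ _ _ → split-α
    ; φ-λ = λ _ → π₂≈λ
    ; φ-ρ = λ _ → π₁≈ρ }

  classification : MonoidalIso M Box ⊎ MonoidalIso M Cat
  classification with em {HasDiagonal}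
  ... | yes diagonal = inj₂ (Cat-iso diagonal)
  ... | no ¬diagonal = inj₁ (Box-iso ¬diagonal)

mainTheorem2 : ExcludedMiddle (suc 0ℓ) →
    Biclosed Box × Biclosed Cat ×
    ((M : Monoidal) → Biclosed M → MonoidalIso M Box ⊎ MonoidalIso M Cat)
mainTheorem2 em = Box-biclosed , Cat-biclosed , Classification.classification (lowerExcludedMiddle em)
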